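{- Let $G_1,G_2$ be ordered cores and suppose there is an order-preserving isomorphism between $G_1$ and $G_2$. Then every order-preserving homomorphism $f : G_1 \rightarrow G_2$ is an order-preserving isomorphism.
   Context: All graphs are undirected, with vertex sets that are subsets of $\mathbb{N}$ (hence linearly ordered). An order-preserving homomorphism from $G$ to $G'$ is a map $f:V(G)\to V(G')$ such that $i\le j$ implies $f(i)\le f(j)$, and $\{i,j\}\in E(G)$ implies $\{f(i),f(j)\}\in E(G')$. An order-preserving isomorphism is an order-preserving homomorphism that is a graph isomorphism. Subgraphs inherit the labels of the vertices. The ordered core of $G$ is a subgraph of $G$ with the smallest number of vertices among subgraphs to which there is an order-preserving homomorphism from $G$. A graph is an ordered core if it is the ordered core of itself. -}

module Defs where

open import Data.Nat using (ℕ; _≤_)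
open import Data.List using (List; length)
open import Data.List.Membership.Propositional using (_∈_)
open import Data.List.Relation.Unary.Unique.Propositional using (Unique)
open import Data.Product using (_×_; Σ; ∃)
open import Relation.Binary.PropositionalEquality using (_≡_)
open import Relation.Nullary using (¬_)

-- A finite simple undirected graph whose vertex set is a finite subset of ℕ,
-- given as a duplicate-free list of naturals (order in the list is irrelevant;
-- the vertex order is the order of ℕ).
record Graph : Set₁ where
  field
    V       : List ℕ
    V-uniq  : Unique V
    E       : ℕ → ℕ → Set
    E-sym   : ∀ {i j} → E i j → E j i
    E-irr   : ∀ {i} → ¬ E i i
    E-dom   : ∀ {i j} → E i j → (i ∈ V) × (j ∈ V)
open Graph public

∣V∣ : Graph → ℕ
∣V∣ G = length (V G)

-- order-preserving homomorphism G → G' (a map on ℕ, only its values on V G matter)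
record IsOrdHom (G G' : Graph) (f : ℕ → ℕ) : Set where
  field
    maps-V   : ∀ {i} → i ∈ V G → f i ∈ V G'
    monotone : ∀ {i j} → i ∈ V G → j ∈ V G → i ≤ j → f i ≤ f j
    pres-E   : ∀ {i j} → E G i j → E G' (f i) (f j)

OrdHom : Graph → Graph → Set
OrdHom G G' = Σ (ℕ → ℕ) (IsOrdHom G G')

record IsOrdIso (G G' : Graph) (f : ℕ → ℕ) : Set where
  field
    hom       : IsOrdHom G G' f
    injective : ∀ {i j} → i ∈ V G → j ∈ V G → f i ≡ f j → i ≡ j
    surjective : ∀ {k} → k ∈ V G' → ∃ λ i → (i ∈ V G) × (f i ≡ k)
    refl-E    : ∀ {i j} → i ∈ V G → j ∈ V G → E G' (f i) (f j) → E G i j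

OrdIso : Graph → Graph → Set
OrdIso G G' = Σ (ℕ → ℕ) (IsOrdIso G G')

record Subgraph (H G : Graph) : Set where
  field
    sub-V : ∀ {i} → i ∈ V H → i ∈ V G
    sub-E : ∀ {i j} → E H i j → E G i j

-- G is an ordered core: G is itself a subgraph with the smallest number of
-- vertices among subgraphs H of G admitting an order-preserving hom G → H.
-- (G is trivially such a subgraph via the identity, so this is the minimality.)
IsOrderedCore : Graph → Set₁
IsOrderedCore G = ∀ (H : Graph) → Subgraph H G → OrdHom G H → ∣V∣ G ≤ ∣V∣ H

-- Let g : G₁ ≅ G₂ and f : G₁ → G₂. The map f ∘ g⁻¹ is an order-preserving
-- homomorphism from G₂ onto the subgraph of G₂ induced by the image of f, so
-- minimality of the ordered core G₂ gives ∣V G₂∣ ≤ ∣f(V G₁)∣ ≤ ∣V G₁∣ = ∣V G₂∣.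
-- Hence f is a bijection V G₁ → V G₂. Two monotone bijections between finite
-- linear orders coincide, so f = g on V G₁, and f reflects edges because g does.
module Submission where

open import Defs
open import Data.Nat using (ℕ; _≤_; _<_; _≟_; z≤n; s≤s)
open import Data.Nat.Properties
  using (≤-total; ≤-antisym; ≤-reflexive; ≤-trans; <-≤-trans; ≤-<-trans; <-irrefl; <⇒≱; ≰⇒>; <-cmp)
open import Data.Nat.Induction using (<-rec)
open import Data.List using (List; []; _∷_; length; map; filter)
open import Data.List.Properties using (filter-notAll; length-map)
open import Data.List.Membership.Propositional using (_∈_; _∉_; find; lose)
open import Data.List.Membership.Propositional.Properties using (∈-filter⁺; ∈-filter⁻; ∈-map⁺; ∈-map⁻)
open import Data.List.Membership.DecPropositional _≟_ using (_∈?_)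
open import Data.List.Relation.Binary.Subset.Propositional using (_⊆_)
open import Data.List.Relation.Unary.Any using (any?; here; there)
import Data.List.Relation.Unary.All as All
open import Data.List.Relation.Unary.AllPairs using (_∷_)
open import Data.List.Relation.Unary.Unique.Propositional using (Unique)
open import Data.List.Relation.Unary.Unique.Propositional.Properties using (filter⁺)
open import Data.Product using (_×_; _,_; proj₁; proj₂; ∃)
open import Data.Sum using (inj₁; inj₂)
open import Data.Empty using (⊥-elim)
open import Function using (_∘_)
open import Relation.Binary using (tri<; tri≈; tri>)
open import Relation.Binary.PropositionalEquality using (_≡_; _≢_; refl; sym; trans; subst; subst₂)
open import Relation.Nullary using (¬_; yes; no; ¬?)
open import Relation.Unary using (Decidable)

remove : ℕ → List ℕ → List ℕ
remove y = filter (λ z → ¬? (y ≟ z))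

length-remove-< : ∀ {y ys} → y ∈ ys → length (remove y ys) < length ys
length-remove-< {y} {ys} y∈ys = filter-notAll (λ z → ¬? (y ≟ z)) ys (lose y∈ys λ y≢y → y≢y refl)

∈-remove⁺ : ∀ {y x ys} → x ∈ ys → y ≢ x → x ∈ remove y ys
∈-remove⁺ {y} = ∈-filter⁺ (λ z → ¬? (y ≟ z))

⊆-remove : ∀ {y xs ys} → xs ⊆ ys → y ∉ xs → xs ⊆ remove y ys
⊆-remove xs⊆ys y∉xs x∈xs = ∈-remove⁺ (xs⊆ys x∈xs) λ { refl → y∉xs x∈xs }

⊆⇒length-≤ : ∀ {xs ys} → Unique xs → xs ⊆ ys → length xs ≤ length ys
⊆⇒length-≤ {[]}     _                 _     = z≤n
⊆⇒length-≤ {x ∷ xs} (x≢xs ∷ uniq) x∷xs⊆ys =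
  <-≤-trans (s≤s (⊆⇒length-≤ uniq (⊆-remove (x∷xs⊆ys ∘ there) x∉xs)))
            (length-remove-< (x∷xs⊆ys (here refl)))
  where
    x∉xs : x ∉ xs
    x∉xs x∈xs = All.lookup x≢xs x∈xs refl

⊆-∉⇒length-< : ∀ {y xs ys} → Unique xs → xs ⊆ ys → y ∈ ys → y ∉ xs → length xs < length ys
⊆-∉⇒length-< uniq xs⊆ys y∈ys y∉xs =
  ≤-<-trans (⊆⇒length-≤ uniq (⊆-remove xs⊆ys y∉xs)) (length-remove-< y∈ys)

⊆-map⇒length-≤ : ∀ (f : ℕ → ℕ) {zs xs} → Unique zs → zs ⊆ map f xs → length zs ≤ length xs
⊆-map⇒length-≤ f {xs = xs} uniq zs⊆ = subst (_ ≤_) (length-map f xs) (⊆⇒length-≤ uniq zs⊆)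

⊆-map-collision⇒length-< : ∀ (f : ℕ → ℕ) {zs xs i j} → Unique zs → zs ⊆ map f xs →
  i ∈ xs → j ∈ xs → i ≢ j → f i ≡ f j → length zs < length xs
⊆-map-collision⇒length-< f {zs} {xs} {i} uniq zs⊆ i∈xs j∈xs i≢j fi≡fj =
  ≤-<-trans (⊆-map⇒length-≤ f uniq zs⊆map-remove) (length-remove-< i∈xs)
  where
    zs⊆map-remove : zs ⊆ map f (remove i xs)
    zs⊆map-remove z∈zs with ∈-map⁻ f (zs⊆ z∈zs)
    ... | x , x∈xs , refl with i ≟ x
    ...   | yes refl = subst (_∈ map f (remove i xs)) (sym fi≡fj) (∈-map⁺ f (∈-remove⁺ j∈xs i≢j))
    ...   | no i≢x   = ∈-map⁺ f (∈-remove⁺ x∈xs i≢x)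

MonotoneOn : List ℕ → (ℕ → ℕ) → Set
MonotoneOn xs f = ∀ {i j} → i ∈ xs → j ∈ xs → i ≤ j → f i ≤ f j

InjectiveOn : List ℕ → (ℕ → ℕ) → Set
InjectiveOn xs f = ∀ {i j} → i ∈ xs → j ∈ xs → f i ≡ f j → i ≡ j

SurjectiveOnto : List ℕ → List ℕ → (ℕ → ℕ) → Set
SurjectiveOnto xs ys f = ∀ {k} → k ∈ ys → ∃ λ i → (i ∈ xs) × (f i ≡ k)

record IsMonotoneBijection (xs ys : List ℕ) (f : ℕ → ℕ) : Set where
  field
    maps-to    : ∀ {i} → i ∈ xs → f i ∈ ys
    monotone   : MonotoneOn xs f
    injective  : InjectiveOn xs f
    surjective : SurjectiveOnto xs ys f

monotone-injective⇒reflects-≤ : ∀ {xs f} → MonotoneOn xs f → InjectiveOn xs f →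
  ∀ {a b} → a ∈ xs → b ∈ xs → f a ≤ f b → a ≤ b
monotone-injective⇒reflects-≤ mono inj {a} {b} a∈ b∈ fa≤fb with ≤-total a b
... | inj₁ a≤b = a≤b
... | inj₂ b≤a = ≤-reflexive (inj a∈ b∈ (≤-antisym fa≤fb (mono b∈ a∈ b≤a)))

agree-below⇒≮ : ∀ {xs ys f g} → IsMonotoneBijection xs ys f → IsMonotoneBijection xs ys g →
  ∀ {i} → (∀ {j} → j < i → j ∈ xs → f j ≡ g j) → i ∈ xs → ¬ f i < g i
agree-below⇒≮ {xs} {f = f} {g} F G {i} agree i∈ fi<gi =
  <-irrefl (F.injective j∈ i∈ (trans (agree j<i j∈) gj≡fi)) j<i
  where
    module F = IsMonotoneBijection F
    module G = IsMonotoneBijection G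
    preimage-of-fi : ∃ λ j → (j ∈ xs) × (g j ≡ f i)
    preimage-of-fi = G.surjective (F.maps-to i∈)
    j = proj₁ preimage-of-fi
    j∈ = proj₁ (proj₂ preimage-of-fi)
    gj≡fi = proj₂ (proj₂ preimage-of-fi)
    j<i : j < i
    j<i = ≰⇒> λ i≤j → <⇒≱ fi<gi (subst (g i ≤_) gj≡fi (G.monotone i∈ j∈ i≤j))

monotone-bijections-agree : ∀ {xs ys f g} → IsMonotoneBijection xs ys f → IsMonotoneBijection xs ys g →
  ∀ {i} → i ∈ xs → f i ≡ g i
monotone-bijections-agree {xs} {f = f} {g} F G {i} = <-rec (λ i → i ∈ xs → f i ≡ g i) step i
  where
    step : ∀ i → (∀ {j} → j < i → j ∈ xs → f j ≡ g j) → i ∈ xs → f i ≡ g i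
    step i agree i∈ with <-cmp (f i) (g i)
    ... | tri< fi<gi _ _ = ⊥-elim (agree-below⇒≮ F G agree i∈ fi<gi)
    ... | tri≈ _ fi≡gi _ = fi≡gi
    ... | tri> _ _ gi<fi = ⊥-elim (agree-below⇒≮ G F (λ j<i j∈ → sym (agree j<i j∈)) i∈ gi<fi)

-- Takes the junk value 0 when k has no preimage in xs.
preimage : (ℕ → ℕ) → List ℕ → ℕ → ℕ
preimage g xs k with any? (λ x → g x ≟ k) xs
... | yes has-preimage = proj₁ (find has-preimage)
... | no  _            = 0

preimage-spec : ∀ g xs {i k} → i ∈ xs → g i ≡ k →
  (preimage g xs k ∈ xs) × (g (preimage g xs k) ≡ k)
preimage-spec g xs {k = k} i∈xs gi≡k with any? (λ x → g x ≟ k) xs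
... | yes has-preimage = proj₂ (find has-preimage)
... | no  no-preimage  = ⊥-elim (no-preimage (lose i∈xs gi≡k))

induced : (G : Graph) {P : ℕ → Set} → Decidable P → Graph
induced G P? = record
  { V      = filter P? (V G)
  ; V-uniq = filter⁺ P? (V-uniq G)
  ; E      = λ a b → E G a b × a ∈ filter P? (V G) × b ∈ filter P? (V G)
  ; E-sym  = λ (e , a∈ , b∈) → E-sym G e , b∈ , a∈
  ; E-irr  = E-irr G ∘ proj₁
  ; E-dom  = proj₂
  }

induced-subgraph : (G : Graph) {P : ℕ → Set} (P? : Decidable P) → Subgraph (induced G P?) G
induced-subgraph G P? = record
  { sub-V = proj₁ ∘ ∈-filter⁻ P? {xs = V G}
  ; sub-E = proj₁
  }

image : (G₁ G₂ : Graph) → (ℕ → ℕ) → Graph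
image G₁ G₂ f = induced G₂ (_∈? map f (V G₁))

image-⊆ : ∀ G₁ G₂ f → V (image G₁ G₂ f) ⊆ map f (V G₁)
image-⊆ G₁ G₂ f = proj₂ ∘ ∈-filter⁻ (_∈? map f (V G₁)) {xs = V G₂}

ordIso⇒monotoneBijection : ∀ {G₁ G₂ g} → IsOrdIso G₁ G₂ g → IsMonotoneBijection (V G₁) (V G₂) g
ordIso⇒monotoneBijection iso = record
  { maps-to    = maps-V
  ; monotone   = monotone
  ; injective  = injective
  ; surjective = surjective
  }
  where open IsOrdIso iso; open IsOrdHom hom

module OrdIsoInverse {G₁ G₂ : Graph} {g : ℕ → ℕ} (iso : IsOrdIso G₁ G₂ g) where
  open IsOrdIso iso
  open IsOrdHom hom

  g⁻¹ : ℕ → ℕ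
  g⁻¹ = preimage g (V G₁)

  g⁻¹-spec : ∀ {k} → k ∈ V G₂ → (g⁻¹ k ∈ V G₁) × (g (g⁻¹ k) ≡ k)
  g⁻¹-spec k∈ = let i , i∈ , gi≡k = surjective k∈ in preimage-spec g (V G₁) i∈ gi≡k

  g⁻¹-∘-g : ∀ {i} → i ∈ V G₁ → g⁻¹ (g i) ≡ i
  g⁻¹-∘-g i∈ = let j∈ , gj≡gi = g⁻¹-spec (maps-V i∈) in injective j∈ i∈ gj≡gi

  g⁻¹-monotone : MonotoneOn (V G₂) g⁻¹
  g⁻¹-monotone k∈ k′∈ k≤k′ =
    let a∈ , ga≡k = g⁻¹-spec k∈ ; b∈ , gb≡k′ = g⁻¹-spec k′∈ in
    monotone-injective⇒reflects-≤ monotone injective a∈ b∈ (subst₂ _≤_ (sym ga≡k) (sym gb≡k′) k≤k′)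

  ∣V∣-≤ : ∣V∣ G₁ ≤ ∣V∣ G₂
  ∣V∣-≤ = ⊆-map⇒length-≤ g⁻¹ (V-uniq G₁)
    λ i∈ → subst (_∈ _) (g⁻¹-∘-g i∈) (∈-map⁺ g⁻¹ (maps-V i∈))

  ordHom-onto-image : ∀ {f} → IsOrdHom G₁ G₂ f → IsOrdHom G₂ (image G₁ G₂ f) (f ∘ g⁻¹)
  ordHom-onto-image {f} f-hom = record
    { maps-V   = maps-to-image
    ; monotone = λ k∈ k′∈ k≤k′ →
        F.monotone (proj₁ (g⁻¹-spec k∈)) (proj₁ (g⁻¹-spec k′∈)) (g⁻¹-monotone k∈ k′∈ k≤k′)
    ; pres-E   = λ e →
        let k∈ , k′∈ = E-dom G₂ e
            a∈ , ga≡k = g⁻¹-spec k∈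
            b∈ , gb≡k′ = g⁻¹-spec k′∈
        in F.pres-E (refl-E a∈ b∈ (subst₂ (E G₂) (sym ga≡k) (sym gb≡k′) e)) , maps-to-image k∈ , maps-to-image k′∈
    }
    where
      module F = IsOrdHom f-hom
      maps-to-image : ∀ {k} → k ∈ V G₂ → f (g⁻¹ k) ∈ V (image G₁ G₂ f)
      maps-to-image k∈ =
        let a∈ = proj₁ (g⁻¹-spec k∈) in
        ∈-filter⁺ (_∈? map f (V G₁)) (F.maps-V a∈) (∈-map⁺ f a∈)

module HomIntoIsomorphicCore {G₁ G₂ : Graph} (core₂ : IsOrderedCore G₂)
                             {g : ℕ → ℕ} (iso : IsOrdIso G₁ G₂ g)
                             {f : ℕ → ℕ} (f-hom : IsOrdHom G₁ G₂ f) where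
  open OrdIsoInverse iso
  module F = IsOrdHom f-hom

  Im : Graph
  Im = image G₁ G₂ f

  ∣V∣-≤-image : ∣V∣ G₂ ≤ ∣V∣ Im
  ∣V∣-≤-image = core₂ Im (induced-subgraph G₂ _) (f ∘ g⁻¹ , ordHom-onto-image f-hom)

  ∣V∣-image-≤ : ∣V∣ Im ≤ ∣V∣ G₁
  ∣V∣-image-≤ = ⊆-map⇒length-≤ f (V-uniq Im) (image-⊆ G₁ G₂ f)

  f-injective : InjectiveOn (V G₁) f
  f-injective {i} {j} i∈ j∈ fi≡fj with i ≟ j
  ... | yes i≡j = i≡j
  ... | no  i≢j = ⊥-elim (<-irrefl refl
        (≤-<-trans (≤-trans ∣V∣-≤ ∣V∣-≤-image)
                   (⊆-map-collision⇒length-< f (V-uniq Im) (image-⊆ G₁ G₂ f) i∈ j∈ i≢j fi≡fj)))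

  f-surjective : SurjectiveOnto (V G₁) (V G₂) f
  f-surjective {k} k∈ with k ∈? map f (V G₁)
  ... | yes k∈image = let i , i∈ , k≡fi = ∈-map⁻ f k∈image in i , i∈ , sym k≡fi
  ... | no  k∉image = ⊥-elim (<-irrefl refl
        (≤-<-trans ∣V∣-≤-image
                   (⊆-∉⇒length-< (V-uniq Im) (induced-subgraph G₂ _ .Subgraph.sub-V) k∈ (k∉image ∘ image-⊆ G₁ G₂ f))))

  f-monotoneBijection : IsMonotoneBijection (V G₁) (V G₂) f
  f-monotoneBijection = record
    { maps-to = F.maps-V ; monotone = F.monotone ; injective = f-injective ; surjective = f-surjective }

  f≗g : ∀ {i} → i ∈ V G₁ → f i ≡ g i
  f≗g = monotone-bijections-agree f-monotoneBijection (ordIso⇒monotoneBijection iso)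

proposition4p4 : (G₁ G₂ : Graph) → IsOrderedCore G₁ → IsOrderedCore G₂ →
    OrdIso G₁ G₂ → (f : ℕ → ℕ) → IsOrdHom G₁ G₂ f → IsOrdIso G₁ G₂ f
proposition4p4 G₁ G₂ _ core₂ (g , iso) f f-hom = record
  { hom        = f-hom
  ; injective  = f-injective
  ; surjective = f-surjective
  ; refl-E     = λ i∈ j∈ e → IsOrdIso.refl-E iso i∈ j∈ (subst₂ (E G₂) (f≗g i∈) (f≗g j∈) e)
  }
  where open HomIntoIsomorphicCore core₂ iso f-hom
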